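{- For every finite simple graph $G$, $\mathcal M(G\times K_2)=\mathcal M(G)$.
   Context: For a graph $G$ with vertex set $V$, the bipartite double cover $G\times K_2$ is the graph with vertex set $V\times\{0,1\}$ in which $(u,i)$ and $(v,j)$ are adjacent iff $uv$ is an edge of $G$ and $i\ne j$. For subsets $X,Y$ of the vertex set of a graph, $e(X,Y)$ is the number of ordered pairs $(x,y)\in X\times Y$ with $xy$ an edge, and $\mathcal M(\cdot):=\max_{X,Y}e(X,Y)/\sqrt{|X||Y|}$, the maximum over all non-empty subsets $X,Y$ of the vertex set. -}

module Defs where

open import Data.Nat using (ℕ; zero; suc; _+_; _*_; _≤_)
open import Data.Bool using (Bool; true; false; _∧_; if_then_else_)
open import Data.Fin using (Fin; zero; suc; splitAt)
open import Data.Fin.Subset using (Subset; ∣_∣; Nonempty)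
open import Data.Vec using (lookup)
open import Data.Sum using (_⊎_; inj₁; inj₂)
open import Data.Product using (Σ; _×_; ∃)
open import Relation.Binary.PropositionalEquality using (_≡_)

record SimpleGraph (n : ℕ) : Set where
  field
    adj    : Fin n → Fin n → Bool
    sym    : ∀ u v → adj u v ≡ adj v u
    irrefl : ∀ v → adj v v ≡ false
open SimpleGraph public

sumFin : (n : ℕ) → (Fin n → ℕ) → ℕ
sumFin zero    f = 0
sumFin (suc n) f = f zero + sumFin n (λ i → f (suc i))

toℕᵇ : Bool → ℕ
toℕᵇ true  = 1
toℕᵇ false = 0

eXY : {n : ℕ} → (Fin n → Fin n → Bool) → Subset n → Subset n → ℕ
eXY {n} a X Y =
  sumFin n (λ x → sumFin n (λ y → toℕᵇ (lookup X x ∧ lookup Y y ∧ a x y)))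

-- Bipartite double cover G × K₂ on vertex set V × {0,1}, encoded as
-- Fin (n + n) ≅ Fin n ⊎ Fin n (inj₁ = layer 0, inj₂ = layer 1).
coverAdj : {n : ℕ} → (Fin n → Fin n → Bool) → Fin (n + n) → Fin (n + n) → Bool
coverAdj {n} a i j with splitAt n i | splitAt n j
... | inj₁ u | inj₁ v = false
... | inj₁ u | inj₂ v = a u v
... | inj₂ u | inj₁ v = a u v
... | inj₂ u | inj₂ v = false

-- e₁/√(x₁y₁) ≤ e₂/√(x₂y₂)  (all quantities nonnegative, x's,y's > 0)
-- is equivalent to e₁² x₂ y₂ ≤ e₂² x₁ y₁.
RatioLe : (e₁ x₁ y₁ e₂ x₂ y₂ : ℕ) → Set
RatioLe e₁ x₁ y₁ e₂ x₂ y₂ = e₁ * e₁ * (x₂ * y₂) ≤ e₂ * e₂ * (x₁ * y₁)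

-- M(A) ≤ M(B): every ratio e(X,Y)/√(|X||Y|) over nonempty X,Y in A
-- is bounded by some such ratio in B (i.e. max over A ≤ max over B).
MLe : {m n : ℕ} → (Fin m → Fin m → Bool) → (Fin n → Fin n → Bool) → Set
MLe {m} {n} a b =
  (X Y : Subset m) → Nonempty X → Nonempty Y →
  Σ (Subset n) λ X' → Σ (Subset n) λ Y' → Nonempty X' × Nonempty Y' ×
    RatioLe (eXY a X Y) (∣ X ∣) (∣ Y ∣) (eXY b X' Y') (∣ X' ∣) (∣ Y' ∣)

MEq : {m n : ℕ} → (Fin m → Fin m → Bool) → (Fin n → Fin n → Bool) → Set
MEq a b = MLe a b × MLe b a

{-# OPTIONS --safe #-}

-- Split a vertex set X of G × K₂ into its layers X₀, X₁. Then
-- e(X,Y) = e(X₀,Y₁) + e(X₁,Y₀) in G and |X| = |X₀| + |X₁|, so the ratio of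
-- (X,Y) is a mediant of the ratios of the blocks (X₀,Y₁) and (X₁,Y₀); by
-- AM–GM a mediant (a+b)/√((p+r)(q+s)) never exceeds the larger of
-- a/√(pq) and b/√(rs). Hence M(G × K₂) ≤ M(G). Conversely X × {0} and
-- Y × {1} reproduce in the cover every ratio of G.

module Submission where

open import Defs using (SimpleGraph; adj; sumFin; toℕᵇ; eXY; coverAdj; RatioLe; MLe; MEq)
open import Data.Nat using (ℕ; zero; suc; _+_; _*_; _≤_; NonZero; z≤n; _≤?_)
open import Data.Nat.Properties
open import Data.Nat.Tactic.RingSolver using (solve-∀)
open import Data.Bool using (Bool; true; false; _∧_)
open import Data.Bool.Properties using (∧-zeroʳ)
open import Data.Fin using (Fin; zero; suc; splitAt; _↑ˡ_; _↑ʳ_)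
open import Data.Fin.Properties using (splitAt-↑ˡ; splitAt-↑ʳ)
open import Data.Fin.Subset using (Subset; ∣_∣; Nonempty; ⊥; ⁅_⁆; _∈_)
open import Data.Fin.Subset.Properties using (∣⊥∣≡0; x∈⁅x⁆; Empty-unique; nonempty?)
open import Data.Vec using ([]; _∷_; lookup; _++_; here; there)
import Data.Vec as Vec
open import Data.Vec.Properties using (lookup-++ˡ; lookup-++ʳ; lookup-replicate)
open import Data.Sum using (_⊎_; inj₁; inj₂; [_,_]′)
open import Data.Product using (Σ; _×_; _,_)
open import Function using (id)
open import Relation.Nullary using (yes; no)
open import Relation.Binary.PropositionalEquality

2*m*n≤m*m+n*n : ∀ m n → 2 * (m * n) ≤ m * m + n * n
2*m*n≤m*m+n*n m n with ≤-total m n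
... | inj₁ m≤n with m≤n⇒∃[o]m+o≡n m≤n
...   | d , refl = ≤-trans (m≤m+n _ (d * d)) (≤-reflexive (square m d))
  where square : ∀ m d → 2 * (m * (m + d)) + d * d ≡ m * m + (m + d) * (m + d)
        square = solve-∀
2*m*n≤m*m+n*n m n | inj₂ n≤m with m≤n⇒∃[o]m+o≡n n≤m
...   | d , refl = ≤-trans (m≤m+n _ (d * d)) (≤-reflexive (square n d))
  where square : ∀ n d → 2 * ((n + d) * n) + d * d ≡ (n + d) * (n + d) + n * n
        square = solve-∀

RatioLe-reflexive : ∀ {e₁ x₁ y₁ e₂ x₂ y₂} → e₁ ≡ e₂ → x₁ ≡ x₂ → y₁ ≡ y₂ →
  RatioLe e₁ x₁ y₁ e₂ x₂ y₂
RatioLe-reflexive refl refl refl = ≤-refl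

RatioLe-enlarge : ∀ e {x y x′ y′} → x ≤ x′ → y ≤ y′ → RatioLe e x′ y′ e x y
RatioLe-enlarge e x≤x′ y≤y′ = *-monoʳ-≤ (e * e) (*-mono-≤ x≤x′ y≤y′)

-- After scaling by s, this is AM–GM for a·s and b·q.
mediant-cross-term : ∀ a b p q r s → .{{NonZero s}} → RatioLe b r s a p q →
  2 * (a * b * (p * q)) ≤ a * a * (p * s + r * q)
mediant-cross-term a b p q r s h = *-cancelˡ-≤ s (begin
  s * (2 * (a * b * (p * q)))                ≡⟨ e₁ a b p q s ⟩
  p * (2 * ((a * s) * (b * q)))              ≤⟨ *-monoʳ-≤ p (2*m*n≤m*m+n*n (a * s) (b * q)) ⟩
  p * ((a * s) * (a * s) + (b * q) * (b * q)) ≡⟨ e₂ a b p q s ⟩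
  a * a * (p * s) * s + q * (b * b * (p * q)) ≤⟨ +-monoʳ-≤ (a * a * (p * s) * s) (*-monoʳ-≤ q h) ⟩
  a * a * (p * s) * s + q * (a * a * (r * s)) ≡⟨ e₃ a p q r s ⟩
  s * (a * a * (p * s + r * q))              ∎)
  where
  open ≤-Reasoning
  e₁ : ∀ a b p q s → s * (2 * (a * b * (p * q))) ≡ p * (2 * ((a * s) * (b * q)))
  e₁ = solve-∀
  e₂ : ∀ a b p q s →
       p * ((a * s) * (a * s) + (b * q) * (b * q)) ≡ a * a * (p * s) * s + q * (b * b * (p * q))
  e₂ = solve-∀
  e₃ : ∀ a p q r s → a * a * (p * s) * s + q * (a * a * (r * s)) ≡ s * (a * a * (p * s + r * q))
  e₃ = solve-∀

RatioLe-mediant : ∀ a b p q r s → .{{NonZero s}} → RatioLe b r s a p q →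
  RatioLe (a + b) (p + r) (q + s) a p q
RatioLe-mediant a b p q r s h = begin
  (a + b) * (a + b) * (p * q)
    ≡⟨ expand a b p q ⟩
  a * a * (p * q) + 2 * (a * b * (p * q)) + b * b * (p * q)
    ≤⟨ +-mono-≤ (+-monoʳ-≤ (a * a * (p * q)) (mediant-cross-term a b p q r s h)) h ⟩
  a * a * (p * q) + a * a * (p * s + r * q) + a * a * (r * s)
    ≡⟨ collect a p q r s ⟩
  a * a * ((p + r) * (q + s)) ∎
  where
  open ≤-Reasoning
  expand : ∀ a b p q →
    (a + b) * (a + b) * (p * q) ≡ a * a * (p * q) + 2 * (a * b * (p * q)) + b * b * (p * q)
  expand = solve-∀
  collect : ∀ a p q r s →
    a * a * (p * q) + a * a * (p * s + r * q) + a * a * (r * s) ≡ a * a * ((p + r) * (q + s))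
  collect = solve-∀

RatioLe-mediant-max : ∀ a b p q r s → .{{NonZero q}} → .{{NonZero s}} →
  RatioLe (a + b) (p + r) (q + s) a p q ⊎ RatioLe (a + b) (p + r) (q + s) b r s
RatioLe-mediant-max a b p q r s with b * b * (p * q) ≤? a * a * (r * s)
... | yes b≤a = inj₁ (RatioLe-mediant a b p q r s b≤a)
... | no b≰a rewrite +-comm a b | +-comm p r | +-comm q s =
  inj₂ (RatioLe-mediant b a r s p q (<⇒≤ (≰⇒> b≰a)))

sumFin-cong : ∀ n {f g : Fin n → ℕ} → (∀ i → f i ≡ g i) → sumFin n f ≡ sumFin n g
sumFin-cong zero    f≗g = refl
sumFin-cong (suc n) f≗g = cong₂ _+_ (f≗g zero) (sumFin-cong n (λ i → f≗g (suc i)))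

sumFin-zero : ∀ n {f : Fin n → ℕ} → (∀ i → f i ≡ 0) → sumFin n f ≡ 0
sumFin-zero n f≗0 = trans (sumFin-cong n f≗0) (sumFin-const-0 n)
  where
  sumFin-const-0 : ∀ n → sumFin n (λ _ → 0) ≡ 0
  sumFin-const-0 zero    = refl
  sumFin-const-0 (suc n) = sumFin-const-0 n

sumFin-splitAt : ∀ m n (f : Fin (m + n) → ℕ) →
  sumFin (m + n) f ≡ sumFin m (λ i → f (i ↑ˡ n)) + sumFin n (λ j → f (m ↑ʳ j))
sumFin-splitAt zero    n f = refl
sumFin-splitAt (suc m) n f =
  trans (cong (f zero +_) (sumFin-splitAt m n (λ i → f (suc i)))) (sym (+-assoc (f zero) _ _))

∣p++q∣≡∣p∣+∣q∣ : ∀ {m n} (p : Subset m) (q : Subset n) → ∣ p ++ q ∣ ≡ ∣ p ∣ + ∣ q ∣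
∣p++q∣≡∣p∣+∣q∣ []          q = refl
∣p++q∣≡∣p∣+∣q∣ (true  ∷ p) q = cong suc (∣p++q∣≡∣p∣+∣q∣ p q)
∣p++q∣≡∣p∣+∣q∣ (false ∷ p) q = ∣p++q∣≡∣p∣+∣q∣ p q

x∈p⇒x↑ˡ∈p++q : ∀ {m n} {p : Subset m} (q : Subset n) {x} → x ∈ p → (x ↑ˡ n) ∈ (p ++ q)
x∈p⇒x↑ˡ∈p++q q here        = here
x∈p⇒x↑ˡ∈p++q q (there x∈p) = there (x∈p⇒x↑ˡ∈p++q q x∈p)

x∈q⇒m↑ʳx∈p++q : ∀ {m n} (p : Subset m) {q : Subset n} {x} → x ∈ q → (m ↑ʳ x) ∈ (p ++ q)
x∈q⇒m↑ʳx∈p++q []      x∈q = x∈q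
x∈q⇒m↑ʳx∈p++q (_ ∷ p) x∈q = there (x∈q⇒m↑ʳx∈p++q p x∈q)

Nonempty⇒∣p∣-nonZero : ∀ {n} (p : Subset n) → Nonempty p → NonZero ∣ p ∣
Nonempty⇒∣p∣-nonZero (true  ∷ p) _                 = _
Nonempty⇒∣p∣-nonZero (false ∷ p) (suc x , there x∈p) = Nonempty⇒∣p∣-nonZero p (x , x∈p)

edgeIndicator : ∀ {n} → (Fin n → Fin n → Bool) → Subset n → Subset n → Fin n → Fin n → ℕ
edgeIndicator a X Y x y = toℕᵇ (lookup X x ∧ lookup Y y ∧ a x y)

edgeIndicator-nonadjacent : ∀ {n} {a : Fin n → Fin n → Bool} X Y {x y} →
  a x y ≡ false → edgeIndicator a X Y x y ≡ 0
edgeIndicator-nonadjacent X Y {x} {y} ¬xy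
  rewrite ¬xy | ∧-zeroʳ (lookup Y y) | ∧-zeroʳ (lookup X x) = refl

module _ {n : ℕ} (a : Fin n → Fin n → Bool) where

  eXY-⊥ˡ : ∀ Y → eXY a ⊥ Y ≡ 0
  eXY-⊥ˡ Y = sumFin-zero n λ x → sumFin-zero n λ y →
    cong (λ b → toℕᵇ (b ∧ lookup Y y ∧ a x y)) (lookup-replicate x false)

  eXY-⊥ʳ : ∀ X → eXY a X ⊥ ≡ 0
  eXY-⊥ʳ X = sumFin-zero n λ x → sumFin-zero n λ y →
    trans (cong (λ b → toℕᵇ (lookup X x ∧ b ∧ a x y)) (lookup-replicate y false))
          (cong toℕᵇ (∧-zeroʳ (lookup X x)))

  nonempty⊎eXY≡0 : ∀ X Y → (Nonempty X × Nonempty Y) ⊎ eXY a X Y ≡ 0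
  nonempty⊎eXY≡0 X Y with nonempty? X | nonempty? Y
  ... | yes X≢∅ | yes Y≢∅ = inj₁ (X≢∅ , Y≢∅)
  ... | no  X≡∅ | _       = inj₂ (trans (cong (λ Z → eXY a Z Y) (Empty-unique X≡∅)) (eXY-⊥ˡ Y))
  ... | yes _   | no  Y≡∅ = inj₂ (trans (cong (eXY a X) (Empty-unique Y≡∅)) (eXY-⊥ʳ X))

  RatioLe-M : ℕ → ℕ → ℕ → Set
  RatioLe-M e x y = Σ (Subset n) λ X → Σ (Subset n) λ Y → Nonempty X × Nonempty Y ×
    RatioLe e x y (eXY a X Y) (∣ X ∣) (∣ Y ∣)

  -- The vertex is needed only when neither block has an edge: then any pair attains the ratio 0.
  RatioLe-M-mediant : Fin n → ∀ X₀ Y₀ X₁ Y₁ →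
    RatioLe-M (eXY a X₀ Y₀ + eXY a X₁ Y₁) (∣ X₀ ∣ + ∣ X₁ ∣) (∣ Y₀ ∣ + ∣ Y₁ ∣)
  RatioLe-M-mediant v X₀ Y₀ X₁ Y₁ with nonempty⊎eXY≡0 X₀ Y₀ | nonempty⊎eXY≡0 X₁ Y₁
  ... | inj₁ (X₀≢∅ , Y₀≢∅) | inj₁ (X₁≢∅ , Y₁≢∅)
    with RatioLe-mediant-max (eXY a X₀ Y₀) (eXY a X₁ Y₁) (∣ X₀ ∣) (∣ Y₀ ∣) (∣ X₁ ∣) (∣ Y₁ ∣)
           {{Nonempty⇒∣p∣-nonZero Y₀ Y₀≢∅}} {{Nonempty⇒∣p∣-nonZero Y₁ Y₁≢∅}}
  ...  | inj₁ ≤block₀ = X₀ , Y₀ , X₀≢∅ , Y₀≢∅ , ≤block₀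
  ...  | inj₂ ≤block₁ = X₁ , Y₁ , X₁≢∅ , Y₁≢∅ , ≤block₁
  RatioLe-M-mediant v X₀ Y₀ X₁ Y₁ | inj₁ (X₀≢∅ , Y₀≢∅) | inj₂ e₁≡0
    rewrite e₁≡0 | +-identityʳ (eXY a X₀ Y₀) =
    X₀ , Y₀ , X₀≢∅ , Y₀≢∅ , RatioLe-enlarge (eXY a X₀ Y₀) (m≤m+n ∣ X₀ ∣ ∣ X₁ ∣) (m≤m+n ∣ Y₀ ∣ ∣ Y₁ ∣)
  RatioLe-M-mediant v X₀ Y₀ X₁ Y₁ | inj₂ e₀≡0 | inj₁ (X₁≢∅ , Y₁≢∅) rewrite e₀≡0 =
    X₁ , Y₁ , X₁≢∅ , Y₁≢∅ , RatioLe-enlarge (eXY a X₁ Y₁) (m≤n+m ∣ X₁ ∣ ∣ X₀ ∣) (m≤n+m ∣ Y₁ ∣ ∣ Y₀ ∣)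
  RatioLe-M-mediant v X₀ Y₀ X₁ Y₁ | inj₂ e₀≡0 | inj₂ e₁≡0 rewrite e₀≡0 | e₁≡0 =
    ⁅ v ⁆ , ⁅ v ⁆ , (v , x∈⁅x⁆ v) , (v , x∈⁅x⁆ v) , z≤n

  coverAdj-↑ˡ-↑ˡ : ∀ u v → coverAdj a (u ↑ˡ n) (v ↑ˡ n) ≡ false
  coverAdj-↑ˡ-↑ˡ u v rewrite splitAt-↑ˡ n u n | splitAt-↑ˡ n v n = refl

  coverAdj-↑ˡ-↑ʳ : ∀ u v → coverAdj a (u ↑ˡ n) (n ↑ʳ v) ≡ a u v
  coverAdj-↑ˡ-↑ʳ u v rewrite splitAt-↑ˡ n u n | splitAt-↑ʳ n n v = refl

  coverAdj-↑ʳ-↑ˡ : ∀ u v → coverAdj a (n ↑ʳ u) (v ↑ˡ n) ≡ a u v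
  coverAdj-↑ʳ-↑ˡ u v rewrite splitAt-↑ʳ n n u | splitAt-↑ˡ n v n = refl

  coverAdj-↑ʳ-↑ʳ : ∀ u v → coverAdj a (n ↑ʳ u) (n ↑ʳ v) ≡ false
  coverAdj-↑ʳ-↑ʳ u v rewrite splitAt-↑ʳ n n u | splitAt-↑ʳ n n v = refl

  eXY-coverAdj : ∀ X₀ X₁ Y₀ Y₁ →
    eXY (coverAdj a) (X₀ ++ X₁) (Y₀ ++ Y₁) ≡ eXY a X₀ Y₁ + eXY a X₁ Y₀
  eXY-coverAdj X₀ X₁ Y₀ Y₁ =
    trans (sumFin-splitAt n n _) (cong₂ _+_ (sumFin-cong n row₀) (sumFin-cong n row₁))
    where
    open ≡-Reasoning
    E : Fin (n + n) → Fin (n + n) → ℕ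
    E = edgeIndicator (coverAdj a) (X₀ ++ X₁) (Y₀ ++ Y₁)
    nonadjacent : ∀ {x y} → coverAdj a x y ≡ false → E x y ≡ 0
    nonadjacent = edgeIndicator-nonadjacent {a = coverAdj a} (X₀ ++ X₁) (Y₀ ++ Y₁)
    row₀ : ∀ u → sumFin (n + n) (E (u ↑ˡ n)) ≡ sumFin n (edgeIndicator a X₀ Y₁ u)
    row₀ u = begin
      sumFin (n + n) (E (u ↑ˡ n))
        ≡⟨ sumFin-splitAt n n _ ⟩
      sumFin n (λ v → E (u ↑ˡ n) (v ↑ˡ n)) + sumFin n (λ v → E (u ↑ˡ n) (n ↑ʳ v))
        ≡⟨ cong₂ _+_ (sumFin-zero n λ v → nonadjacent (coverAdj-↑ˡ-↑ˡ u v)) (sumFin-cong n block) ⟩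
      sumFin n (edgeIndicator a X₀ Y₁ u) ∎
      where
      block : ∀ v → E (u ↑ˡ n) (n ↑ʳ v) ≡ edgeIndicator a X₀ Y₁ u v
      block v rewrite lookup-++ˡ X₀ X₁ u | lookup-++ʳ Y₀ Y₁ v | coverAdj-↑ˡ-↑ʳ u v = refl
    row₁ : ∀ u → sumFin (n + n) (E (n ↑ʳ u)) ≡ sumFin n (edgeIndicator a X₁ Y₀ u)
    row₁ u = begin
      sumFin (n + n) (E (n ↑ʳ u))
        ≡⟨ sumFin-splitAt n n _ ⟩
      sumFin n (λ v → E (n ↑ʳ u) (v ↑ˡ n)) + sumFin n (λ v → E (n ↑ʳ u) (n ↑ʳ v))
        ≡⟨ cong₂ _+_ (sumFin-cong n block) (sumFin-zero n λ v → nonadjacent (coverAdj-↑ʳ-↑ʳ u v)) ⟩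
      sumFin n (edgeIndicator a X₁ Y₀ u) + 0
        ≡⟨ +-identityʳ _ ⟩
      sumFin n (edgeIndicator a X₁ Y₀ u) ∎
      where
      block : ∀ v → E (n ↑ʳ u) (v ↑ˡ n) ≡ edgeIndicator a X₁ Y₀ u v
      block v rewrite lookup-++ʳ X₀ X₁ u | lookup-++ˡ Y₀ Y₁ v | coverAdj-↑ʳ-↑ˡ u v = refl

  MLe-cover : MLe a (coverAdj a)
  MLe-cover X Y (x , x∈X) (y , y∈Y) =
    X ++ ∅ , ∅ ++ Y , (x ↑ˡ n , x∈p⇒x↑ˡ∈p++q ∅ x∈X) , (n ↑ʳ y , x∈q⇒m↑ʳx∈p++q ∅ y∈Y) , equal
    where
    ∅ : Subset n
    ∅ = ⊥
    equal : RatioLe (eXY a X Y) (∣ X ∣) (∣ Y ∣)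
                    (eXY (coverAdj a) (X ++ ∅) (∅ ++ Y)) (∣ X ++ ∅ ∣) (∣ ∅ ++ Y ∣)
    equal = RatioLe-reflexive
      (sym (trans (eXY-coverAdj X ∅ ∅ Y) (trans (cong (eXY a X Y +_) (eXY-⊥ˡ ∅)) (+-identityʳ _))))
      (sym (trans (∣p++q∣≡∣p∣+∣q∣ X ∅) (trans (cong (∣ X ∣ +_) (∣⊥∣≡0 n)) (+-identityʳ _))))
      (sym (trans (∣p++q∣≡∣p∣+∣q∣ ∅ Y) (cong (_+ ∣ Y ∣) (∣⊥∣≡0 n))))

  cover-MLe : MLe (coverAdj a) a
  cover-MLe X Y (k , _) _ with Vec.splitAt n X | Vec.splitAt n Y
  ... | X₀ , X₁ , refl | Y₀ , Y₁ , refl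
    rewrite eXY-coverAdj X₀ X₁ Y₀ Y₁ | ∣p++q∣≡∣p∣+∣q∣ X₀ X₁ | ∣p++q∣≡∣p∣+∣q∣ Y₀ Y₁
          | +-comm ∣ Y₀ ∣ ∣ Y₁ ∣ =
    RatioLe-M-mediant ([ id , id ]′ (splitAt n k)) X₀ Y₁ X₁ Y₀

corollary1 : (n : ℕ) (G : SimpleGraph n) →
    MEq (coverAdj (adj G)) (adj G)
corollary1 n G = cover-MLe (adj G) , MLe-cover (adj G)
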